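{- Let $n$ be a positive integer. The total number of parts equal to $1$ in all partitions of $n$ (counted with multiplicity, summed over all partitions of $n$) is equal to $$\sum_{k=2}^{n+1} \phi(k)\, S^{(2)}_{n+1,k}.$$
   Context: A partition of a positive integer $m$ is a nonincreasing sequence of positive integers (its parts) summing to $m$. For integers $r\ge 1$, $k\ge 1$, $m\ge 1$, $S^{(r)}_{m,k}$ denotes the number of parts equal to $k$ (counted with multiplicity) summed over all partitions of $m$ whose smallest part is at least $r$. $\phi$ is Euler's totient function. -}

module Defs where

open import Data.Nat using (ℕ; zero; suc; _+_; _∸_; _≤_; _≤?_; _≟_)
open import Data.Nat.GCD using (gcd)
open import Data.List using (List; []; _∷_; map; concatMap; length; filter; upTo)
open import Data.Nat.ListAction using (sum)
open import Relation.Nullary.Decidable using (does)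
open import Data.Bool using (if_then_else_)

φ : ℕ → ℕ
φ k = length (filter (λ i → gcd (suc i) k ≟ 1) (upTo k))

-- partitionsIn r b m : all partitions of m (as nonincreasing lists of parts,
-- largest first) whose parts all lie in the range [r, b].
-- Defined by recursion on a fuel argument f (we use f = m, enough since
-- every part is ≥ 1 when r ≥ 1).
partitionsFuel : ℕ → ℕ → ℕ → ℕ → List (List ℕ)
partitionsFuel f       r b zero    = [] ∷ []
partitionsFuel zero    r b (suc m) = []
partitionsFuel (suc f) r b (suc m) =
  concatMap
    (λ i → let p = suc i in
       if does (r ≤? p) then
         (if does (p ≤? b) then
            (if does (p ≤? suc m) then
               map (p ∷_) (partitionsFuel f r p (suc m ∸ p))
             else [])
          else [])
       else [])
    (upTo (suc m))

partitionsAtLeast : ℕ → ℕ → List (List ℕ)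
partitionsAtLeast r m = partitionsFuel m r m m

partitions : ℕ → List (List ℕ)
partitions m = partitionsAtLeast 1 m

count : ℕ → List ℕ → ℕ
count k xs = length (filter (λ x → x ≟ k) xs)

S : ℕ → ℕ → ℕ → ℕ
S r m k = sum (map (count k) (partitionsAtLeast r m))

sumRange : ℕ → ℕ → (ℕ → ℕ) → ℕ
sumRange a b f = sum (map (λ i → f (a + i)) (upTo (suc b ∸ a)))

-- Let p r b m count the partitions of m into parts in [r, b].  Removing j copies of a part k
-- shows that the parts equal to k, summed over those partitions, number
-- ∑_{j ≥ 1} p r b (m − j k) when r ≤ k ≤ b.  For k = 1, stripping all ones turns the left-hand
-- side into ∑_s p 2 (n + 1) s · (n − s).  On the right the same formula, after exchanging sums,
-- gives ∑_s p 2 (n + 1) s · ∑_{2 ≤ d ∣ n + 1 − s} φ d, and Gauss's identity ∑_{d ∣ t} φ d = t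
-- makes the inner sum n − s.
module Submission where

open import Defs
open import Data.Bool using (Bool; true; false; if_then_else_)
open import Data.List using (List; []; _∷_; map; concatMap; length; filter; upTo; applyUpTo; _++_)
open import Data.List.Properties using (map-++; map-upTo)
open import Data.Nat using (ℕ; zero; suc; _+_; _*_; _∸_; _≤_; _<_; _≥_; s≤s; z<s; s<s; s≤s⁻¹; _≤?_; _≟_; _≤′_; ≤′-refl; ≤′-step; ≢-nonZero; >-nonZero)
open import Data.Nat.Properties
open import Algebra.Properties.CommutativeSemigroup +-commutativeSemigroup using () renaming (interchange to +-interchange)
open import Algebra.Properties.CommutativeSemigroup *-commutativeSemigroup using () renaming (x∙yz≈z∙yx to x*[y*z]≡z*[y*x])
open import Data.Nat.ListAction using (sum)
open import Data.Nat.ListAction.Properties using (sum-++)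
open import Data.Nat.Divisibility using (_∣_; _∣?_; divides; ∣⇒≤; ∣-refl; 1∣_; ∣m+n∣m⇒∣n; ∣m∣n⇒∣m+n)
open import Data.Nat.GCD using (gcd; gcd[m,n]∣m; gcd[m,n]∣n; gcd[m,n]≢0; c*gcd[m,n]≡gcd[cm,cn])
open import Data.Nat.Induction using (<-rec)
open import Data.Sum using (inj₁)
open import Function using (_∘_; const)
open import Relation.Nullary using (Dec; yes; no; ¬_)
open import Relation.Nullary.Decidable using (does; dec-true; dec-false)
open import Relation.Nullary.Negation using (contradiction)
open import Relation.Binary.PropositionalEquality
open ≡-Reasoning

∑ : ℕ → (ℕ → ℕ) → ℕ
∑ zero    f = 0
∑ (suc n) f = f 0 + ∑ n (f ∘ suc)

∑-cong : ∀ n {f g : ℕ → ℕ} → (∀ i → i < n → f i ≡ g i) → ∑ n f ≡ ∑ n g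
∑-cong zero    eq = refl
∑-cong (suc n) eq = cong₂ _+_ (eq 0 z<s) (∑-cong n (λ i i<n → eq (suc i) (s<s i<n)))

∑-zero : ∀ n {f : ℕ → ℕ} → (∀ i → i < n → f i ≡ 0) → ∑ n f ≡ 0
∑-zero zero    eq = refl
∑-zero (suc n) eq = cong₂ _+_ (eq 0 z<s) (∑-zero n (λ i i<n → eq (suc i) (s<s i<n)))

∑-ones : ∀ n → ∑ n (const 1) ≡ n
∑-ones zero    = refl
∑-ones (suc n) = cong suc (∑-ones n)

∑-distrib-+ : ∀ n (f g : ℕ → ℕ) → ∑ n (λ i → f i + g i) ≡ ∑ n f + ∑ n g
∑-distrib-+ zero    f g = refl
∑-distrib-+ (suc n) f g =
  trans (cong (f 0 + g 0 +_) (∑-distrib-+ n (f ∘ suc) (g ∘ suc))) (+-interchange (f 0) (g 0) _ _)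

*-distribˡ-∑ : ∀ n c (f : ℕ → ℕ) → c * ∑ n f ≡ ∑ n (λ i → c * f i)
*-distribˡ-∑ zero    c f = *-zeroʳ c
*-distribˡ-∑ (suc n) c f = trans (*-distribˡ-+ c (f 0) _) (cong (c * f 0 +_) (*-distribˡ-∑ n c (f ∘ suc)))

∑-split : ∀ a b (f : ℕ → ℕ) → ∑ (a + b) f ≡ ∑ a f + ∑ b (λ i → f (a + i))
∑-split zero    b f = refl
∑-split (suc a) b f = trans (cong (f 0 +_) (∑-split a b (f ∘ suc))) (sym (+-assoc (f 0) _ _))

∑-suc : ∀ n (f : ℕ → ℕ) → ∑ (suc n) f ≡ ∑ n f + f n
∑-suc n f = begin
  ∑ (suc n) f                   ≡⟨ cong (λ l → ∑ l f) (+-comm 1 n) ⟩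
  ∑ (n + 1) f                   ≡⟨ ∑-split n 1 f ⟩
  ∑ n f + (f (n + 0) + 0)       ≡⟨ cong (∑ n f +_) (trans (+-identityʳ _) (cong f (+-identityʳ n))) ⟩
  ∑ n f + f n                   ∎

∑-comm : ∀ a b (f : ℕ → ℕ → ℕ) → ∑ a (λ i → ∑ b (f i)) ≡ ∑ b (λ j → ∑ a (λ i → f i j))
∑-comm zero    b f = sym (∑-zero b (λ _ _ → refl))
∑-comm (suc a) b f =
  trans (cong (∑ b (f 0) +_) (∑-comm a b (f ∘ suc))) (sym (∑-distrib-+ b (f 0) (λ j → ∑ a (λ i → f (suc i) j))))

∑-update : ∀ n {f g : ℕ → ℕ} j e → j < n → (∀ i → i < n → i ≢ j → f i ≡ g i) → f j ≡ g j + e →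
  ∑ n f ≡ ∑ n g + e
∑-update (suc n) {f} {g} zero e _ eq eqj =
  trans (cong₂ _+_ eqj (∑-cong n (λ i i<n → eq (suc i) (s<s i<n) (λ ()))))
        (trans (+-assoc (g 0) e _) (trans (cong (g 0 +_) (+-comm e _)) (sym (+-assoc (g 0) _ e))))
∑-update (suc n) {f} {g} (suc j) e (s<s j<n) eq eqj =
  trans (cong₂ _+_ (eq 0 z<s (λ ())) (∑-update n j e j<n (λ i i<n i≢j → eq (suc i) (s<s i<n) (i≢j ∘ suc-injective)) eqj))
        (sym (+-assoc (g 0) _ e))

∑-prefix-sums : ∀ n (f : ℕ → ℕ) → ∑ n (λ s → ∑ (suc s) f) ≡ ∑ (suc n) (λ s → f s * (n ∸ s))
∑-prefix-sums zero    f = sym (trans (+-identityʳ _) (*-zeroʳ (f 0)))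
∑-prefix-sums (suc n) f = begin
  ∑ (suc n) (λ s → ∑ (suc s) f)                   ≡⟨ ∑-suc n (λ s → ∑ (suc s) f) ⟩
  ∑ n (λ s → ∑ (suc s) f) + ∑ (suc n) f           ≡⟨ cong (_+ ∑ (suc n) f) (∑-prefix-sums n f) ⟩
  ∑ (suc n) (λ s → f s * (n ∸ s)) + ∑ (suc n) f   ≡⟨ sym (∑-distrib-+ (suc n) (λ s → f s * (n ∸ s)) f) ⟩
  ∑ (suc n) (λ s → f s * (n ∸ s) + f s)           ≡⟨ ∑-cong (suc n) (λ s s≤n → step s (s≤s⁻¹ s≤n)) ⟩
  ∑ (suc n) F                                     ≡⟨ sym (+-identityʳ _) ⟩
  ∑ (suc n) F + 0                                 ≡⟨ cong (∑ (suc n) F +_) (sym last) ⟩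
  ∑ (suc n) F + F (suc n)                         ≡⟨ sym (∑-suc (suc n) F) ⟩
  ∑ (suc (suc n)) F                               ∎
  where
  F : ℕ → ℕ
  F s = f s * (suc n ∸ s)
  last : F (suc n) ≡ 0
  last = trans (cong (f (suc n) *_) (n∸n≡0 n)) (*-zeroʳ (f (suc n)))
  step : ∀ s → s ≤ n → f s * (n ∸ s) + f s ≡ F s
  step s s≤n = begin
    f s * (n ∸ s) + f s     ≡⟨ +-comm _ (f s) ⟩
    f s + f s * (n ∸ s)     ≡⟨ sym (*-suc (f s) (n ∸ s)) ⟩
    f s * suc (n ∸ s)       ≡⟨ cong (f s *_) (sym (+-∸-assoc 1 s≤n)) ⟩
    f s * (suc n ∸ s)       ∎

sum-applyUpTo : ∀ (f : ℕ → ℕ) n → sum (applyUpTo f n) ≡ ∑ n f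
sum-applyUpTo f zero    = refl
sum-applyUpTo f (suc n) = cong (f 0 +_) (sum-applyUpTo (f ∘ suc) n)

sum-map-upTo : ∀ (f : ℕ → ℕ) n → sum (map f (upTo n)) ≡ ∑ n f
sum-map-upTo f n = trans (cong sum (map-upTo f n)) (sum-applyUpTo f n)

sum-map-concatMap : ∀ {A B : Set} (w : B → ℕ) (g : A → List B) xs →
  sum (map w (concatMap g xs)) ≡ sum (map (λ x → sum (map w (g x))) xs)
sum-map-concatMap w g []       = refl
sum-map-concatMap w g (x ∷ xs) = begin
  sum (map w (g x ++ concatMap g xs))           ≡⟨ cong sum (map-++ w (g x) _) ⟩
  sum (map w (g x) ++ map w (concatMap g xs))   ≡⟨ sum-++ (map w (g x)) _ ⟩
  sum (map w (g x)) + sum (map w (concatMap g xs))        ≡⟨ cong (sum (map w (g x)) +_) (sum-map-concatMap w g xs) ⟩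
  sum (map w (g x)) + sum (map (λ x → sum (map w (g x))) xs) ∎

keepIf : Bool → ℕ → ℕ
keepIf c x = if c then x else 0

keepIf-zero : ∀ c → keepIf c 0 ≡ 0
keepIf-zero true  = refl
keepIf-zero false = refl

𝟙 : {P : Set} → Dec P → ℕ
𝟙 P? = keepIf (does P?) 1

𝟙-yes : {P : Set} (P? : Dec P) → P → 𝟙 P? ≡ 1
𝟙-yes P? p rewrite dec-true P? p = refl

𝟙-no : {P : Set} (P? : Dec P) → ¬ P → 𝟙 P? ≡ 0
𝟙-no P? ¬p rewrite dec-false P? ¬p = refl

𝟙-cong : {P Q : Set} (P? : Dec P) (Q? : Dec Q) → (P → Q) → (Q → P) → 𝟙 P? ≡ 𝟙 Q?
𝟙-cong (yes p) Q? f g = sym (𝟙-yes Q? (f p))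
𝟙-cong (no ¬p) Q? f g = sym (𝟙-no Q? (¬p ∘ g))

length-filter≡sum-𝟙 : ∀ {P : ℕ → Set} (P? : ∀ x → Dec (P x)) xs → length (filter P? xs) ≡ sum (map (𝟙 ∘ P?) xs)
length-filter≡sum-𝟙 P? []       = refl
length-filter≡sum-𝟙 P? (x ∷ xs) with does (P? x)
... | true  = cong suc (length-filter≡sum-𝟙 P? xs)
... | false = length-filter≡sum-𝟙 P? xs

∑-𝟙-≟ : ∀ n c → c < n → ∑ n (λ j → 𝟙 (j ≟ c)) ≡ 1
∑-𝟙-≟ (suc n) zero    _          = cong suc (∑-zero n (λ _ _ → refl))
∑-𝟙-≟ (suc n) (suc c) (s<s c<n) = ∑-𝟙-≟ n c c<n

shift : ℕ → (ℕ → ℕ) → ℕ → ℕ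
shift c g s = keepIf (does (c ≤? s)) (g (s ∸ c))

shift-< : ∀ c g {s} → s < c → shift c g s ≡ 0
shift-< c g {s} s<c rewrite dec-false (c ≤? s) (<⇒≱ s<c) = refl

shift-≥ : ∀ c g {s} → c ≤ s → shift c g s ≡ g (s ∸ c)
shift-≥ c g {s} c≤s rewrite dec-true (c ≤? s) c≤s = refl

shift-cong : ∀ c f g s → (c ≤ s → f (s ∸ c) ≡ g (s ∸ c)) → shift c f s ≡ shift c g s
shift-cong c f g s eq with c ≤? s
... | yes c≤s = trans (shift-≥ c f c≤s) (trans (eq c≤s) (sym (shift-≥ c g c≤s)))
... | no  c≰s = trans (shift-< c f (≰⇒> c≰s)) (sym (shift-< c g (≰⇒> c≰s)))

shift-distrib-+ : ∀ c f g s → shift c (λ t → f t + g t) s ≡ shift c f s + shift c g s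
shift-distrib-+ c f g s with does (c ≤? s)
... | true  = refl
... | false = refl

∑-shift : ∀ c q (H : ℕ → ℕ → ℕ) g → (∀ s → H s 0 ≡ 0) →
  ∑ (c + q) (λ s → H s (shift c g s)) ≡ ∑ q (λ i → H (c + i) (g i))
∑-shift c q H g H0 = begin
  ∑ (c + q) (λ s → H s (shift c g s))                             ≡⟨ ∑-split c q _ ⟩
  ∑ c (λ s → H s (shift c g s)) + ∑ q (λ i → H (c + i) (shift c g (c + i)))
    ≡⟨ cong₂ _+_ (∑-zero c (λ s s<c → trans (cong (H s) (shift-< c g s<c)) (H0 s)))
                 (∑-cong q (λ i _ → cong (H (c + i)) (trans (shift-≥ c g (m≤m+n c i)) (cong g (m+n∸m≡n c i))))) ⟩
  ∑ q (λ i → H (c + i) (g i))                                     ∎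

∑-prefix-shift : ∀ c g t → 1 ≤ c → ∑ (suc t) (shift c g) ≡ shift c (λ x → ∑ (suc x) g) t
∑-prefix-shift c g t c≥1 with c ≤? t
... | no  c≰t = trans (∑-zero (suc t) (λ s s≤t → shift-< c g (<-≤-trans s≤t (≰⇒> c≰t))))
                      (sym (shift-< c (λ x → ∑ (suc x) g) (≰⇒> c≰t)))
... | yes c≤t = begin
  ∑ (suc t) (shift c g)               ≡⟨ cong (λ l → ∑ l (shift c g)) (sym c+[1+t∸c]≡1+t) ⟩
  ∑ (c + suc (t ∸ c)) (shift c g)     ≡⟨ ∑-shift c (suc (t ∸ c)) (λ _ x → x) g (λ _ → refl) ⟩
  ∑ (suc (t ∸ c)) g                   ≡⟨ sym (shift-≥ c (λ x → ∑ (suc x) g) c≤t) ⟩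
  shift c (λ x → ∑ (suc x) g) t       ∎
  where
  c+[1+t∸c]≡1+t : c + suc (t ∸ c) ≡ suc t
  c+[1+t∸c]≡1+t = trans (+-suc c (t ∸ c)) (cong suc (m+[n∸m]≡n c≤t))

shift-recurrence-unique : ∀ c {A F G : ℕ → ℕ} → 1 ≤ c →
  (∀ m → F m ≡ A m + shift c F m) → (∀ m → G m ≡ A m + shift c G m) → ∀ m → F m ≡ G m
shift-recurrence-unique c {A} {F} {G} c≥1 F-rec G-rec = <-rec _ step
  where
  step : ∀ m → (∀ {y} → y < m → F y ≡ G y) → F m ≡ G m
  step m ih = begin
    F m                ≡⟨ F-rec m ⟩
    A m + shift c F m  ≡⟨ cong (A m +_) (shift-cong c F G m (λ c≤m → ih (∸-monoʳ-< c≥1 c≤m))) ⟩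
    A m + shift c G m  ≡⟨ sym (G-rec m) ⟩
    G m                ∎

conv : (ℕ → ℕ) → (ℕ → ℕ) → ℕ → ℕ
conv h g m = ∑ m (λ s → h (m ∸ s) * g s)

conv-congʳ : ∀ h {f g} m → (∀ s → s < m → f s ≡ g s) → conv h f m ≡ conv h g m
conv-congʳ h m eq = ∑-cong m (λ s s<m → cong (h (m ∸ s) *_) (eq s s<m))

conv-distribʳ-+ : ∀ h f g m → conv h (λ s → f s + g s) m ≡ conv h f m + conv h g m
conv-distribʳ-+ h f g m =
  trans (∑-cong m (λ s _ → *-distribˡ-+ (h (m ∸ s)) (f s) (g s))) (∑-distrib-+ m _ _)

conv-shift : ∀ h c g m → conv h (shift c g) m ≡ shift c (conv h g) m
conv-shift h c g m with c ≤? m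
... | no  c≰m = trans (∑-zero m vanish) (sym (shift-< c (conv h g) (≰⇒> c≰m)))
  where
  vanish : ∀ s → s < m → h (m ∸ s) * shift c g s ≡ 0
  vanish s s<m = trans (cong (h (m ∸ s) *_) (shift-< c g (<-trans s<m (≰⇒> c≰m)))) (*-zeroʳ (h (m ∸ s)))
... | yes c≤m = begin
  ∑ m (λ s → h (m ∸ s) * shift c g s)
    ≡⟨ cong (λ l → ∑ l (λ s → h (m ∸ s) * shift c g s)) (sym (m+[n∸m]≡n c≤m)) ⟩
  ∑ (c + (m ∸ c)) (λ s → h (m ∸ s) * shift c g s)
    ≡⟨ ∑-shift c (m ∸ c) (λ s x → h (m ∸ s) * x) g (λ s → *-zeroʳ (h (m ∸ s))) ⟩
  ∑ (m ∸ c) (λ i → h (m ∸ (c + i)) * g i)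
    ≡⟨ ∑-cong (m ∸ c) (λ i _ → cong (λ x → h x * g i) (sym (∸-+-assoc m c i))) ⟩
  conv h g (m ∸ c)
    ≡⟨ sym (shift-≥ c (conv h g) c≤m) ⟩
  shift c (conv h g) m                                ∎

𝟙∣-periodic : ∀ k x → 𝟙 (k ∣? x + k) ≡ 𝟙 (k ∣? x)
𝟙∣-periodic k x = 𝟙-cong (k ∣? x + k) (k ∣? x)
  (λ k∣x+k → ∣m+n∣m⇒∣n (subst (k ∣_) (+-comm x k) k∣x+k) ∣-refl) (λ k∣x → ∣m∣n⇒∣m+n k∣x ∣-refl)

𝟙∣-small : ∀ k x → 0 < x → x < k → 𝟙 (k ∣? x) ≡ 0
𝟙∣-small k (suc x) _ x<k = 𝟙-no (k ∣? suc x) (λ k∣x → <⇒≱ x<k (∣⇒≤ k∣x))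

conv-∣-+ : ∀ k g q → 1 ≤ k → conv (𝟙 ∘ (k ∣?_)) g (q + k) ≡ g q + conv (𝟙 ∘ (k ∣?_)) g q
conv-∣-+ k@(suc k′) g q _ = begin
  ∑ (q + k) (λ s → D (q + k ∸ s) * g s)                                    ≡⟨ ∑-split q k _ ⟩
  ∑ q (λ s → D (q + k ∸ s) * g s) + ∑ k (λ j → D (q + k ∸ (q + j)) * g (q + j))
    ≡⟨ cong₂ _+_ (∑-cong q (λ s s<q → cong (_* g s) (trans (cong D (+-∸-comm k (<⇒≤ s<q))) (𝟙∣-periodic k (q ∸ s))))) window ⟩
  conv D g q + g q                                                         ≡⟨ +-comm _ (g q) ⟩
  g q + conv D g q                                                         ∎
  where
  D : ℕ → ℕ
  D = 𝟙 ∘ (k ∣?_)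
  first : D (q + k ∸ (q + 0)) * g (q + 0) ≡ g q
  first rewrite [m+n]∸[m+o]≡n∸o q k 0 | 𝟙-yes (k ∣? k) ∣-refl | +-identityʳ q = +-identityʳ (g q)
  -- for 0 < j < k, k ∸ j is not a multiple of k
  rest : ∑ k′ (λ j → D (q + k ∸ (q + suc j)) * g (q + suc j)) ≡ 0
  rest = ∑-zero k′ (λ j j<k′ → cong (_* g (q + suc j))
    (trans (cong D ([m+n]∸[m+o]≡n∸o q k (suc j))) (𝟙∣-small k (k′ ∸ j) (m<n⇒0<n∸m j<k′) (s≤s (m∸n≤m k′ j)))))
  window : ∑ k (λ j → D (q + k ∸ (q + j)) * g (q + j)) ≡ g q
  window = trans (cong₂ _+_ first rest) (+-identityʳ (g q))

conv-∣-unfold : ∀ k g m → 1 ≤ k → conv (𝟙 ∘ (k ∣?_)) g m ≡ shift k (λ t → g t + conv (𝟙 ∘ (k ∣?_)) g t) m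
conv-∣-unfold k g m k≥1 with k ≤? m
... | yes k≤m = begin
  conv (𝟙 ∘ (k ∣?_)) g m                           ≡⟨ cong (conv (𝟙 ∘ (k ∣?_)) g) (sym (m∸n+n≡m k≤m)) ⟩
  conv (𝟙 ∘ (k ∣?_)) g (m ∸ k + k)                 ≡⟨ conv-∣-+ k g (m ∸ k) k≥1 ⟩
  g (m ∸ k) + conv (𝟙 ∘ (k ∣?_)) g (m ∸ k)         ≡⟨ sym (shift-≥ k (λ t → g t + conv (𝟙 ∘ (k ∣?_)) g t) k≤m) ⟩
  shift k (λ t → g t + conv (𝟙 ∘ (k ∣?_)) g t) m   ∎
... | no  k≰m = trans
  (∑-zero m (λ s s<m → cong (_* g s) (𝟙∣-small k (m ∸ s) (m<n⇒0<n∸m s<m) (≤-<-trans (m∸n≤m m s) (≰⇒> k≰m)))))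
  (sym (shift-< k (λ t → g t + conv (𝟙 ∘ (k ∣?_)) g t) (≰⇒> k≰m)))

φ≡∑ : ∀ k → φ k ≡ ∑ k (λ i → 𝟙 (gcd (suc i) k ≟ 1))
φ≡∑ k = trans (length-filter≡sum-𝟙 (λ i → gcd (suc i) k ≟ 1) (upTo k)) (sum-map-upTo _ k)

∑-multiples : ∀ g (h : ℕ → ℕ) d → 1 ≤ g → (∀ y → ¬ g ∣ y → h y ≡ 0) →
  ∑ (g * d) (h ∘ suc) ≡ ∑ d (λ y → h (g * suc y))
∑-multiples g h zero g≥1 h0 = cong (λ l → ∑ l (h ∘ suc)) (*-zeroʳ g)
∑-multiples g@(suc g′) h (suc d) g≥1 h0 = begin
  ∑ (g * suc d) (h ∘ suc)                                   ≡⟨ cong (λ l → ∑ l (h ∘ suc)) (*-suc g d) ⟩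
  ∑ (g + g * d) (h ∘ suc)                                   ≡⟨ ∑-split g (g * d) (h ∘ suc) ⟩
  ∑ g (h ∘ suc) + ∑ (g * d) (λ i → h (suc (g + i)))
    ≡⟨ cong₂ _+_ first (∑-cong (g * d) (λ i _ → cong h (sym (+-suc g i)))) ⟩
  h (g * 1) + ∑ (g * d) (λ i → h (g + suc i))               ≡⟨ cong (h (g * 1) +_) (∑-multiples g (h ∘ (g +_)) d g≥1 h0′) ⟩
  h (g * 1) + ∑ d (λ y → h (g + g * suc y))
    ≡⟨ cong (h (g * 1) +_) (∑-cong d (λ y _ → cong h (sym (*-suc g (suc y))))) ⟩
  ∑ (suc d) (λ y → h (g * suc y))                           ∎
  where
  h0′ : ∀ y → ¬ g ∣ y → h (g + y) ≡ 0
  h0′ y g∤y = h0 (g + y) (λ g∣g+y → g∤y (∣m+n∣m⇒∣n g∣g+y ∣-refl))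
  first : ∑ g (h ∘ suc) ≡ h (g * 1)
  first = begin
    ∑ g (h ∘ suc)                 ≡⟨ ∑-suc g′ (h ∘ suc) ⟩
    ∑ g′ (h ∘ suc) + h g          ≡⟨ cong (_+ h g) (∑-zero g′ (λ x x<g′ → h0 (suc x) (λ g∣x → <⇒≱ (s<s x<g′) (∣⇒≤ g∣x)))) ⟩
    h g                           ≡⟨ cong h (sym (*-identityʳ g)) ⟩
    h (g * 1)                     ∎

-- Gauss's identity ∑_{d ∣ t} φ d = t comes from classifying 1 ≤ x + 1 ≤ t by d = t / gcd (x + 1) t.
isCofactor : ℕ → ℕ → ℕ → ℕ
isCofactor t x d = 𝟙 (gcd (suc x) t * d ≟ t)

∑-isCofactor-φ : ∀ g d → 1 ≤ g → 1 ≤ d → ∑ (g * d) (λ x → isCofactor (g * d) x d) ≡ φ d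
∑-isCofactor-φ g@(suc _) d@(suc _) g≥1 _ = begin
  ∑ (g * d) (λ x → isCofactor t x d)      ≡⟨ ∑-cong (g * d) (λ x _ → 𝟙-cong (gcd (suc x) t * d ≟ t) (gcd (suc x) t ≟ g)
                                                  (λ eq → *-cancelʳ-≡ _ g d eq) (λ eq → cong (_* d) eq)) ⟩
  ∑ (g * d) (h ∘ suc)                     ≡⟨ ∑-multiples g h d g≥1 h0 ⟩
  ∑ d (λ y → h (g * suc y))               ≡⟨ ∑-cong d (λ y _ → 𝟙-cong (gcd (g * suc y) t ≟ g) (gcd (suc y) d ≟ 1)
                                                  (λ eq → *-cancelˡ-≡ _ 1 g (trans (c*gcd[m,n]≡gcd[cm,cn] g (suc y) d) (trans eq (sym (*-identityʳ g)))))
                                                  (λ eq → trans (sym (c*gcd[m,n]≡gcd[cm,cn] g (suc y) d)) (trans (cong (g *_) eq) (*-identityʳ g)))) ⟩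
  ∑ d (λ i → 𝟙 (gcd (suc i) d ≟ 1))       ≡⟨ sym (φ≡∑ d) ⟩
  φ d                                     ∎
  where
  t : ℕ
  t = g * d
  h : ℕ → ℕ
  h y = 𝟙 (gcd y t ≟ g)
  h0 : ∀ y → ¬ g ∣ y → h y ≡ 0
  h0 y g∤y = 𝟙-no (gcd y t ≟ g) (λ eq → g∤y (subst (_∣ y) eq (gcd[m,n]∣m y t)))

∑-isCofactor : ∀ d t → 1 ≤ d → 1 ≤ t → ∑ t (λ x → isCofactor t x d) ≡ 𝟙 (d ∣? t) * φ d
∑-isCofactor d t d≥1 t≥1 with d ∣? t
... | no d∤t = ∑-zero t (λ x _ → 𝟙-no (gcd (suc x) t * d ≟ t) (λ eq → d∤t (divides (gcd (suc x) t) (sym eq))))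
... | yes (divides zero t≡0) = contradiction t≡0 (<⇒≢ t≥1 ∘ sym)
... | yes (divides g@(suc _) t≡g*d) = begin
  ∑ t (λ x → isCofactor t x d)              ≡⟨ cong (λ t → ∑ t (λ x → isCofactor t x d)) t≡g*d ⟩
  ∑ (g * d) (λ x → isCofactor (g * d) x d)  ≡⟨ ∑-isCofactor-φ g d z<s d≥1 ⟩
  φ d                                       ≡⟨ sym (+-identityʳ (φ d)) ⟩
  1 * φ d                                   ∎

∑-isCofactor-unique : ∀ n t x → 1 ≤ t → t ≤ n → ∑ n (λ j → isCofactor t x (suc j)) ≡ 1
∑-isCofactor-unique n t x t≥1 t≤n with gcd[m,n]∣n (suc x) t
... | divides zero t≡0 = contradiction t≡0 (<⇒≢ t≥1 ∘ sym)
... | divides (suc q) t≡q+1*G = trans (∑-cong n (λ j _ → 𝟙-cong (G * suc j ≟ t) (j ≟ q) to from)) (∑-𝟙-≟ n q q<n)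
  where
  G : ℕ
  G = gcd (suc x) t
  t≡G*q+1 : t ≡ G * suc q
  t≡G*q+1 = trans t≡q+1*G (*-comm (suc q) G)
  G≢0 : G ≢ 0
  G≢0 = gcd[m,n]≢0 (suc x) t (inj₁ (λ ()))
  q<n : q < n
  q<n = ≤-trans (∣⇒≤ {{>-nonZero t≥1}} (divides G t≡G*q+1)) t≤n
  to : ∀ {j} → G * suc j ≡ t → j ≡ q
  to {j} eq = suc-injective (*-cancelˡ-≡ (suc j) (suc q) G {{≢-nonZero G≢0}} (trans eq t≡G*q+1))
  from : ∀ {j} → j ≡ q → G * suc j ≡ t
  from refl = sym t≡G*q+1

∑-divisors-φ : ∀ n t → 1 ≤ t → t ≤ n → ∑ n (λ j → 𝟙 (suc j ∣? t) * φ (suc j)) ≡ t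
∑-divisors-φ n t t≥1 t≤n = begin
  ∑ n (λ j → 𝟙 (suc j ∣? t) * φ (suc j))       ≡⟨ ∑-cong n (λ j _ → sym (∑-isCofactor (suc j) t z<s t≥1)) ⟩
  ∑ n (λ j → ∑ t (λ x → isCofactor t x (suc j)))  ≡⟨ ∑-comm n t (λ j x → isCofactor t x (suc j)) ⟩
  ∑ t (λ x → ∑ n (λ j → isCofactor t x (suc j)))  ≡⟨ ∑-cong t (λ x _ → ∑-isCofactor-unique n t x t≥1 t≤n) ⟩
  ∑ t (const 1)                                 ≡⟨ ∑-ones t ⟩
  t                                             ∎

∑-divisors≥2-φ : ∀ n t → 1 ≤ t → t ≤ suc n → ∑ n (λ i → 𝟙 (2 + i ∣? t) * φ (2 + i)) ≡ t ∸ 1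
∑-divisors≥2-φ n t t≥1 t≤1+n = begin
  ∑ n (λ i → 𝟙 (2 + i ∣? t) * φ (2 + i))           ≡⟨ sym (m+n∸m≡n 1 _) ⟩
  1 + ∑ n (λ i → 𝟙 (2 + i ∣? t) * φ (2 + i)) ∸ 1   ≡⟨ cong (λ x → x + ∑ n (λ i → 𝟙 (2 + i ∣? t) * φ (2 + i)) ∸ 1) (sym d=1) ⟩
  ∑ (suc n) (λ j → 𝟙 (suc j ∣? t) * φ (suc j)) ∸ 1  ≡⟨ cong (_∸ 1) (∑-divisors-φ (suc n) t t≥1 t≤1+n) ⟩
  t ∸ 1                                            ∎
  where
  d=1 : 𝟙 (1 ∣? t) * φ 1 ≡ 1
  d=1 = cong (_* φ 1) (𝟙-yes (1 ∣? t) (1∣ t))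

totalWeight : (w : List ℕ → ℕ) (fuel r b m : ℕ) → ℕ
totalWeight w f r b m = sum (map w (partitionsFuel f r b m))

record Additive (w : List ℕ → ℕ) (a : ℕ → ℕ) : Set where
  field
    weight-∷ : ∀ p ps → w (p ∷ ps) ≡ a p + w ps

open Additive

const1-additive : Additive (const 1) (const 0)
const1-additive .weight-∷ p ps = refl

count-additive : ∀ k → Additive (count k) (λ p → 𝟙 (p ≟ k))
count-additive k .weight-∷ p ps with does (p ≟ k)
... | true  = refl
... | false = refl

sum-map-if : ∀ (w : List ℕ → ℕ) c L → sum (map w (if c then L else [])) ≡ keepIf c (sum (map w L))
sum-map-if w true  L = refl
sum-map-if w false L = refl

sum-map-prepend : ∀ {w a} → Additive w a → ∀ p L →
  sum (map w (map (p ∷_) L)) ≡ a p * sum (map (const 1) L) + sum (map w L)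
sum-map-prepend {a = a} add p []       = sym (cong (_+ 0) (*-zeroʳ (a p)))
sum-map-prepend {w} {a} add p (l ∷ L) = begin
  w (p ∷ l) + sum (map w (map (p ∷_) L))                    ≡⟨ cong₂ _+_ (weight-∷ add p l) (sum-map-prepend add p L) ⟩
  a p + w l + (a p * sum (map (const 1) L) + sum (map w L))  ≡⟨ +-interchange (a p) (w l) _ _ ⟩
  a p + a p * sum (map (const 1) L) + (w l + sum (map w L))  ≡⟨ cong (_+ (w l + sum (map w L))) (sym (*-suc (a p) _)) ⟩
  a p * suc (sum (map (const 1) L)) + (w l + sum (map w L))  ∎

inRange : (r b p x : ℕ) → ℕ
inRange r b p x = keepIf (does (r ≤? p)) (keepIf (does (p ≤? b)) x)

inRange-zero : ∀ r b p → inRange r b p 0 ≡ 0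
inRange-zero r b p = trans (cong (keepIf (does (r ≤? p))) (keepIf-zero _)) (keepIf-zero _)

inRange-< : ∀ r {b p} x → b < p → inRange r b p x ≡ 0
inRange-< r {b} {p} x b<p rewrite dec-false (p ≤? b) (<⇒≱ b<p) = keepIf-zero _

inRange-≱ : ∀ r p b x → ¬ r ≤ p → inRange r b p x ≡ 0
inRange-≱ r p b x r≰p rewrite dec-false (r ≤? p) r≰p = refl

inRange-top : ∀ {r p} x → r ≤ p → inRange r p p x ≡ x
inRange-top {r} {p} x r≤p rewrite dec-true (r ≤? p) r≤p | dec-true (p ≤? p) ≤-refl = refl

inRange-raise : ∀ r b p x → p ≢ suc b → inRange r (suc b) p x ≡ inRange r b p x
inRange-raise r b p x p≢1+b = cong (λ c → keepIf (does (r ≤? p)) (keepIf c x)) does-≤-raise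
  where
  does-≤-raise : does (p ≤? suc b) ≡ does (p ≤? b)
  does-≤-raise with p ≤? b
  ... | yes p≤b = trans (dec-true (p ≤? suc b) (m≤n⇒m≤1+n p≤b)) (sym (dec-true (p ≤? b) p≤b))
  ... | no  p≰b = trans (dec-false (p ≤? suc b) (λ p≤1+b → p≰b (s≤s⁻¹ (≤∧≢⇒< p≤1+b p≢1+b))))
                        (sym (dec-false (p ≤? b) p≰b))

inRange-cong-≤ : ∀ r b p {x y} → (p ≤ b → x ≡ y) → inRange r b p x ≡ inRange r b p y
inRange-cong-≤ r b p {x} {y} eq with p ≤? b
... | yes p≤b = cong (inRange r b p) (eq p≤b)
... | no  p≰b = trans (inRange-< r x (≰⇒> p≰b)) (sym (inRange-< r y (≰⇒> p≰b)))

inRange-bound : ∀ r {b b′ p} x → p ≤ b → p ≤ b′ → inRange r b p x ≡ inRange r b′ p x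
inRange-bound r {b} {b′} {p} x p≤b p≤b′ rewrite dec-true (p ≤? b) p≤b | dec-true (p ≤? b′) p≤b′ = refl

totalWeight-unfold : ∀ {w a} → Additive w a → ∀ f r b m →
  totalWeight w (suc f) r b (suc m) ≡
  ∑ (suc m) (λ i → inRange r b (suc i) (a (suc i) * totalWeight (const 1) f r (suc i) (m ∸ i) + totalWeight w f r (suc i) (m ∸ i)))
totalWeight-unfold {w} {a} add f r b m =
  trans (sum-map-concatMap w withLargestPart (upTo (suc m))) (trans (sum-map-upTo _ (suc m)) (∑-cong (suc m) sum-withLargestPart))
  where
  withLargestPart : ℕ → List (List ℕ)
  withLargestPart i =
    if does (r ≤? suc i) then
      (if does (suc i ≤? b) then
         (if does (suc i ≤? suc m) then map (suc i ∷_) (partitionsFuel f r (suc i) (m ∸ i)) else [])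
       else [])
    else []
  sum-withLargestPart : ∀ i → i < suc m → sum (map w (withLargestPart i)) ≡
    inRange r b (suc i) (a (suc i) * totalWeight (const 1) f r (suc i) (m ∸ i) + totalWeight w f r (suc i) (m ∸ i))
  sum-withLargestPart i i≤m =
    trans (sum-map-if w (does (r ≤? p)) _) (cong (keepIf (does (r ≤? p)))
      (trans (sum-map-if w (does (p ≤? b)) _) (cong (keepIf (does (p ≤? b)))
        (trans (sum-map-if w (does (p ≤? suc m)) (map (p ∷_) L))
          (trans (cong (λ c → keepIf c (sum (map w (map (p ∷_) L)))) (dec-true (p ≤? suc m) i≤m)) (sum-map-prepend add p L))))))
    where
    p : ℕ
    p = suc i
    L : List (List ℕ)
    L = partitionsFuel f r p (m ∸ i)

totalWeight-fuel : ∀ {w a} → Additive w a → ∀ f f′ r b m → m ≤ f → m ≤ f′ →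
  totalWeight w f r b m ≡ totalWeight w f′ r b m
totalWeight-fuel add f f′ r b zero _ _ = refl
totalWeight-fuel {w} {a} add (suc f) (suc f′) r b (suc m) (s≤s m≤f) (s≤s m≤f′) = begin
  totalWeight w (suc f) r b (suc m)   ≡⟨ totalWeight-unfold add f r b m ⟩
  ∑ (suc m) (summand f)               ≡⟨ ∑-cong (suc m) (λ i _ → cong (inRange r b (suc i)) (cong₂ _+_
                                           (cong (a (suc i) *_) (totalWeight-fuel const1-additive f f′ r (suc i) (m ∸ i) (m∸i≤ m≤f i) (m∸i≤ m≤f′ i)))
                                           (totalWeight-fuel add f f′ r (suc i) (m ∸ i) (m∸i≤ m≤f i) (m∸i≤ m≤f′ i)))) ⟩
  ∑ (suc m) (summand f′)              ≡⟨ sym (totalWeight-unfold add f′ r b m) ⟩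
  totalWeight w (suc f′) r b (suc m)  ∎
  where
  summand : ℕ → ℕ → ℕ
  summand g i = inRange r b (suc i) (a (suc i) * totalWeight (const 1) g r (suc i) (m ∸ i) + totalWeight w g r (suc i) (m ∸ i))
  m∸i≤ : ∀ {g} → m ≤ g → ∀ i → m ∸ i ≤ g
  m∸i≤ m≤g i = ≤-trans (m∸n≤m m i) m≤g

totalWeight-vanishing : ∀ {w a} → Additive w a → w [] ≡ 0 → ∀ f r b m → (∀ p → p ≤ b → a p ≡ 0) →
  totalWeight w f r b m ≡ 0
totalWeight-vanishing add w[]≡0 f       r b zero    _  = trans (+-identityʳ _) w[]≡0
totalWeight-vanishing add w[]≡0 zero    r b (suc m) _  = refl
totalWeight-vanishing {a = a} add w[]≡0 (suc f) r b (suc m) a≡0 =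
  trans (totalWeight-unfold add f r b m) (∑-zero (suc m) (λ i _ →
    trans (inRange-cong-≤ r b (suc i) (λ i<b → cong₂ _+_ (cong (_* totalWeight (const 1) f r (suc i) (m ∸ i)) (a≡0 (suc i) i<b))
            (totalWeight-vanishing add w[]≡0 f r (suc i) (m ∸ i) (λ p p≤1+i → a≡0 p (≤-trans p≤1+i i<b)))))
          (inRange-zero r b (suc i))))

weight : (w : List ℕ → ℕ) (r b m : ℕ) → ℕ
weight w r b m = totalWeight w m r b m

npart : (r b m : ℕ) → ℕ
npart = weight (const 1)

occurrences : (k r b m : ℕ) → ℕ
occurrences k = weight (count k)

-- The weight of p ∷ π summed over the partitions π of t into parts in [r, p].
prependWeight : (w : List ℕ → ℕ) (a : ℕ → ℕ) (r p t : ℕ) → ℕ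
prependWeight w a r p t = a p * npart r p t + weight w r p t

weight-unfold : ∀ {w a} → Additive w a → ∀ r b m →
  weight w r b (suc m) ≡ ∑ (suc m) (λ i → inRange r b (suc i) (prependWeight w a r (suc i) (m ∸ i)))
weight-unfold {w} {a} add r b m = trans (totalWeight-unfold add m r b m) (∑-cong (suc m) (λ i _ →
  cong (inRange r b (suc i)) (cong₂ _+_
    (cong (a (suc i) *_) (totalWeight-fuel const1-additive m (m ∸ i) r (suc i) (m ∸ i) (m∸n≤m m i) ≤-refl))
    (totalWeight-fuel add m (m ∸ i) r (suc i) (m ∸ i) (m∸n≤m m i) ≤-refl))))

weight-bound : ∀ {w a} → Additive w a → ∀ r b b′ m → m ≤ b → m ≤ b′ → weight w r b m ≡ weight w r b′ m
weight-bound add r b b′ zero    _   _    = refl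
weight-bound {w} {a} add r b b′ (suc m) m≤b m≤b′ =
  trans (weight-unfold add r b m)
        (trans (∑-cong (suc m) (λ i i<m → inRange-bound r (prependWeight w a r (suc i) (m ∸ i)) (≤-trans i<m m≤b) (≤-trans i<m m≤b′)))
               (sym (weight-unfold add r b′ m)))

-- Raising the largest allowed part from b to b + 1 adds the partitions with largest part b + 1.
weight-raise : ∀ {w a} → Additive w a → ∀ r b m → r ≤ suc b →
  weight w r (suc b) m ≡ weight w r b m + shift (suc b) (prependWeight w a r (suc b)) m
weight-raise {w} {a} add r b zero r≤1+b =
  sym (trans (cong (weight w r b 0 +_) (shift-< (suc b) (prependWeight w a r (suc b)) z<s)) (+-identityʳ _))
weight-raise {w} {a} add r b (suc m) r≤1+b = go (suc b ≤? suc m)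
  where
  rest : ℕ → ℕ
  rest i = prependWeight w a r (suc i) (m ∸ i)
  term : ℕ → ℕ → ℕ
  term c i = inRange r c (suc i) (rest i)
  go : Dec (suc b ≤ suc m) →
    weight w r (suc b) (suc m) ≡ weight w r b (suc m) + shift (suc b) (prependWeight w a r (suc b)) (suc m)
  go (yes (s≤s b≤m)) = begin
    weight w r (suc b) (suc m)   ≡⟨ weight-unfold add r (suc b) m ⟩
    ∑ (suc m) (term (suc b))     ≡⟨ ∑-update (suc m) b (rest b) (s≤s b≤m)
                                      (λ i _ i≢b → inRange-raise r b (suc i) (rest i) (i≢b ∘ suc-injective)) top ⟩
    ∑ (suc m) (term b) + rest b  ≡⟨ cong₂ _+_ (sym (weight-unfold add r b m))
                                             (sym (shift-≥ (suc b) (prependWeight w a r (suc b)) (s≤s b≤m))) ⟩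
    weight w r b (suc m) + shift (suc b) (prependWeight w a r (suc b)) (suc m) ∎
    where
    top : term (suc b) b ≡ term b b + rest b
    top = trans (inRange-top (rest b) r≤1+b) (cong (_+ rest b) (sym (inRange-< r (rest b) ≤-refl)))
  go (no b≰m) = begin
    weight w r (suc b) (suc m)   ≡⟨ weight-unfold add r (suc b) m ⟩
    ∑ (suc m) (term (suc b))     ≡⟨ ∑-cong (suc m) (λ i i≤m → inRange-raise r b (suc i) (rest i) (λ { refl → b≰m i≤m })) ⟩
    ∑ (suc m) (term b)           ≡⟨ sym (weight-unfold add r b m) ⟩
    weight w r b (suc m)         ≡⟨ sym (+-identityʳ _) ⟩
    weight w r b (suc m) + 0     ≡⟨ cong (weight w r b (suc m) +_)
                                         (sym (shift-< (suc b) (prependWeight w a r (suc b)) (≰⇒> b≰m))) ⟩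
    weight w r b (suc m) + shift (suc b) (prependWeight w a r (suc b)) (suc m) ∎

weight-raise-skip : ∀ {w a} → Additive w a → ∀ r b m → ¬ r ≤ suc b → weight w r (suc b) m ≡ weight w r b m
weight-raise-skip add r b zero    _      = refl
weight-raise-skip {w} {a} add r b (suc m) r≰1+b =
  trans (weight-unfold add r (suc b) m) (trans (∑-cong (suc m) (λ i _ → unchanged (suc i) (prependWeight w a r (suc i) (m ∸ i)))) (sym (weight-unfold add r b m)))
  where
  unchanged : ∀ p x → inRange r (suc b) p x ≡ inRange r b p x
  unchanged p x with p ≟ suc b
  ... | yes refl = trans (inRange-≱ r p (suc b) x r≰1+b) (sym (inRange-≱ r p b x r≰1+b))
  ... | no  p≢1+b = inRange-raise r b p x p≢1+b

npart-raise : ∀ r b m → r ≤ suc b → npart r (suc b) m ≡ npart r b m + shift (suc b) (npart r (suc b)) m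
npart-raise = weight-raise const1-additive

occurrences-below : ∀ k r b m → b < k → occurrences k r b m ≡ 0
occurrences-below k r b m b<k = totalWeight-vanishing (count-additive k) refl m r b m
  (λ p p≤b → 𝟙-no (p ≟ k) (<⇒≢ (≤-<-trans p≤b b<k)))

npart-0 : ∀ r m → npart r 0 (suc m) ≡ 0
npart-0 r m = trans (weight-unfold const1-additive r 0 m) (∑-zero (suc m) (λ i _ → inRange-< r (npart r (suc i) (m ∸ i)) (z<s {i})))

npart-1-1 : ∀ m → npart 1 1 m ≡ 1
npart-1-1 zero    = refl
npart-1-1 (suc m) = trans (npart-raise 1 0 (suc m) ≤-refl) (cong₂ _+_ (npart-0 1 m) (trans (shift-≥ 1 (npart 1 1) {suc m} z<s) (npart-1-1 m)))

npart-2-1 : ∀ m → npart 2 1 (suc m) ≡ 0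
npart-2-1 m = trans (weight-raise-skip const1-additive 2 0 (suc m) (λ { (s≤s ()) })) (npart-0 2 m)

-- Strip the parts equal to 1: what remains is a partition of some u ≤ t into parts ≥ 2.
npart-1≡∑-npart-2 : ∀ d t → npart 1 (suc d) t ≡ ∑ (suc t) (npart 2 (suc d))
npart-1≡∑-npart-2 zero    t = trans (npart-1-1 t) (cong suc (sym (∑-zero t (λ s _ → npart-2-1 s))))
npart-1≡∑-npart-2 (suc d) t = shift-recurrence-unique b z<s F-rec G-rec t
  where
  b : ℕ
  b = suc (suc d)
  ih : ∀ t → npart 1 (suc d) t ≡ ∑ (suc t) (npart 2 (suc d))
  ih t = npart-1≡∑-npart-2 d t
  F-rec : ∀ t → npart 1 b t ≡ npart 1 (suc d) t + shift b (npart 1 b) t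
  F-rec t = npart-raise 1 (suc d) t z<s
  G-rec : ∀ t → ∑ (suc t) (npart 2 b) ≡ npart 1 (suc d) t + shift b (λ x → ∑ (suc x) (npart 2 b)) t
  G-rec t = begin
    ∑ (suc t) (npart 2 b)
      ≡⟨ ∑-cong (suc t) (λ u _ → npart-raise 2 (suc d) u (s≤s z<s)) ⟩
    ∑ (suc t) (λ u → npart 2 (suc d) u + shift b (npart 2 b) u)
      ≡⟨ ∑-distrib-+ (suc t) (npart 2 (suc d)) (shift b (npart 2 b)) ⟩
    ∑ (suc t) (npart 2 (suc d)) + ∑ (suc t) (shift b (npart 2 b))  ≡⟨ cong₂ _+_ (sym (ih t))
                                                                          (∑-prefix-shift b (npart 2 b) t z<s) ⟩
    npart 1 (suc d) t + shift b (λ x → ∑ (suc x) (npart 2 b)) t    ∎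

occurrences≡conv : ∀ {k r b} → 1 ≤ k → r ≤ k → k ≤ b → ∀ m → occurrences k r b m ≡ conv (𝟙 ∘ (k ∣?_)) (npart r b) m
occurrences≡conv {k@(suc k′)} {r} k≥1 r≤k k≤b = go (≤⇒≤′ k≤b)
  where
  D : ℕ → ℕ
  D = 𝟙 ∘ (k ∣?_)
  prepend : ℕ → ℕ → ℕ
  prepend = prependWeight (count k) (λ p → 𝟙 (p ≟ k)) r
  go : ∀ {b} → k ≤′ b → ∀ m → occurrences k r b m ≡ conv D (npart r b) m
  go ≤′-refl = shift-recurrence-unique k k≥1 F-rec G-rec
    where
    prepend-k : ∀ t → prepend k t ≡ npart r k t + occurrences k r k t
    prepend-k t = cong (_+ occurrences k r k t) (trans (cong (_* npart r k t) (𝟙-yes (k ≟ k) refl)) (*-identityˡ _))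
    F-rec : ∀ m → occurrences k r k m ≡ shift k (npart r k) m + shift k (occurrences k r k) m
    F-rec m = begin
      occurrences k r k m                                    ≡⟨ weight-raise (count-additive k) r k′ m r≤k ⟩
      occurrences k r k′ m + shift k (prepend k) m           ≡⟨ cong₂ _+_ (occurrences-below k r k′ m ≤-refl)
                                                                         (shift-cong k (prepend k) (λ t → npart r k t + occurrences k r k t) m (λ _ → prepend-k (m ∸ k))) ⟩
      shift k (λ t → npart r k t + occurrences k r k t) m    ≡⟨ shift-distrib-+ k (npart r k) (occurrences k r k) m ⟩
      shift k (npart r k) m + shift k (occurrences k r k) m  ∎
    G-rec : ∀ m → conv D (npart r k) m ≡ shift k (npart r k) m + shift k (conv D (npart r k)) m
    G-rec m = trans (conv-∣-unfold k (npart r k) m k≥1) (shift-distrib-+ k (npart r k) (conv D (npart r k)) m)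
  go (≤′-step {b} k≤′b) = shift-recurrence-unique (suc b) z<s F-rec G-rec
    where
    k≤b′ : k ≤ b
    k≤b′ = ≤′⇒≤ k≤′b
    r≤1+b : r ≤ suc b
    r≤1+b = ≤-trans r≤k (m≤n⇒m≤1+n k≤b′)
    prepend-1+b : ∀ t → prepend (suc b) t ≡ occurrences k r (suc b) t
    prepend-1+b t = cong (λ c → c * npart r (suc b) t + occurrences k r (suc b) t)
      (𝟙-no (suc b ≟ k) (λ 1+b≡k → <⇒≱ (s≤s k≤b′) (≤-reflexive 1+b≡k)))
    F-rec : ∀ m → occurrences k r (suc b) m ≡ occurrences k r b m + shift (suc b) (occurrences k r (suc b)) m
    F-rec m = trans (weight-raise (count-additive k) r b m r≤1+b)
      (cong (occurrences k r b m +_) (shift-cong (suc b) (prepend (suc b)) (occurrences k r (suc b)) m (λ _ → prepend-1+b (m ∸ suc b))))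
    G-rec : ∀ m → conv D (npart r (suc b)) m ≡ occurrences k r b m + shift (suc b) (conv D (npart r (suc b))) m
    G-rec m = begin
      conv D (npart r (suc b)) m
        ≡⟨ conv-congʳ D m (λ s _ → npart-raise r b s r≤1+b) ⟩
      conv D (λ s → npart r b s + shift (suc b) (npart r (suc b)) s) m   ≡⟨ conv-distribʳ-+ D (npart r b) _ m ⟩
      conv D (npart r b) m + conv D (shift (suc b) (npart r (suc b))) m
        ≡⟨ cong₂ _+_ (sym (go k≤′b m)) (conv-shift D (suc b) (npart r (suc b)) m) ⟩
      occurrences k r b m + shift (suc b) (conv D (npart r (suc b))) m   ∎

occurrences-of-1 : ∀ n → 1 ≤ n → occurrences 1 1 n n ≡ ∑ (suc n) (λ s → npart 2 (suc n) s * (n ∸ s))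
occurrences-of-1 n@(suc n′) n≥1 = begin
  occurrences 1 1 n n                          ≡⟨ occurrences≡conv ≤-refl ≤-refl n≥1 n ⟩
  conv (𝟙 ∘ (1 ∣?_)) (npart 1 n) n
    ≡⟨ ∑-cong n (λ s _ → trans (cong (_* npart 1 n s) (𝟙-yes (1 ∣? n ∸ s) (1∣ _))) (*-identityˡ _)) ⟩
  ∑ n (npart 1 n)                              ≡⟨ ∑-cong n (λ s _ → npart-1≡∑-npart-2 n′ s) ⟩
  ∑ n (λ s → ∑ (suc s) (npart 2 n))            ≡⟨ ∑-cong n (λ s s<n → ∑-cong (suc s) (λ u u≤s →
                                                    raise-bound u (≤-trans (s≤s⁻¹ u≤s) (<⇒≤ s<n)))) ⟩
  ∑ n (λ s → ∑ (suc s) (npart 2 (suc n)))      ≡⟨ ∑-prefix-sums n (npart 2 (suc n)) ⟩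
  ∑ (suc n) (λ s → npart 2 (suc n) s * (n ∸ s)) ∎
  where
  raise-bound : ∀ u → u ≤ n → npart 2 n u ≡ npart 2 (suc n) u
  raise-bound u u≤n = weight-bound const1-additive 2 n (suc n) u u≤n (m≤n⇒m≤1+n u≤n)

∑-φ-occurrences : ∀ n → ∑ n (λ i → φ (2 + i) * occurrences (2 + i) 2 (suc n) (suc n)) ≡ ∑ (suc n) (λ s → npart 2 (suc n) s * (n ∸ s))
∑-φ-occurrences n = begin
  ∑ n (λ i → φ (2 + i) * occurrences (2 + i) 2 M M)
    ≡⟨ ∑-cong n (λ i i<n → trans (cong (φ (2 + i) *_) (occurrences≡conv z<s (s≤s z<s) (s≤s i<n) M))
                                 (*-distribˡ-∑ M (φ (2 + i)) (λ s → 𝟙 (2 + i ∣? M ∸ s) * Q s))) ⟩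
  ∑ n (λ i → ∑ M (λ s → φ (2 + i) * (𝟙 (2 + i ∣? M ∸ s) * Q s)))
    ≡⟨ ∑-comm n M (λ i s → φ (2 + i) * (𝟙 (2 + i ∣? M ∸ s) * Q s)) ⟩
  ∑ M (λ s → ∑ n (λ i → φ (2 + i) * (𝟙 (2 + i ∣? M ∸ s) * Q s)))
    ≡⟨ ∑-cong M (λ s _ → trans (∑-cong n (λ i _ → x*[y*z]≡z*[y*x] (φ (2 + i)) (𝟙 (2 + i ∣? M ∸ s)) (Q s)))
                               (sym (*-distribˡ-∑ n (Q s) (λ i → 𝟙 (2 + i ∣? M ∸ s) * φ (2 + i))))) ⟩
  ∑ M (λ s → Q s * ∑ n (λ i → 𝟙 (2 + i ∣? M ∸ s) * φ (2 + i)))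
    ≡⟨ ∑-cong M (λ s s<M → cong (Q s *_) (trans (∑-divisors≥2-φ n (M ∸ s) (m<n⇒0<n∸m s<M) (m∸n≤m M s))
                                               (trans (∸-+-assoc M s 1) (cong (M ∸_) (+-comm s 1))))) ⟩
  ∑ M (λ s → Q s * (n ∸ s))                    ∎
  where
  M : ℕ
  M = suc n
  Q : ℕ → ℕ
  Q = npart 2 M

theorem2 : (n : ℕ) → n ≥ 1 →
    sum (map (count 1) (partitions n)) ≡ sumRange 2 (n + 1) (λ k → φ k * S 2 (n + 1) k)
theorem2 n n≥1 rewrite +-comm n 1 = begin
  occurrences 1 1 n n                                       ≡⟨ occurrences-of-1 n n≥1 ⟩
  ∑ (suc n) (λ s → npart 2 (suc n) s * (n ∸ s))             ≡⟨ sym (∑-φ-occurrences n) ⟩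
  ∑ n (λ i → φ (2 + i) * occurrences (2 + i) 2 (suc n) (suc n))  ≡⟨ sym (sum-map-upTo _ n) ⟩
  sumRange 2 (suc n) (λ k → φ k * S 2 (suc n) k)            ∎
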